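{- For each standard graph $G$ there is a canonical labeled graph $G'$ such that the standard decompositions of $G$ and of $G'$ are in bijection, and the standard components of $G$ and of $G'$ are in bijection.
   Context: A labeled graph: finite node set, directed edges without loops or parallel edges, integer labeling $\ell$ of nodes. It is standard if all labels are $\ge0$ and $\ell(a)\le\ell(b)$ for each edge $(a,b)$. For graphs with the same nodes and edges, $\oplus,\ominus$ add/subtract labels nodewise. A standard component of $G$ is a labeled graph $H$ with the same nodes and edges as $G$, all labels in $\{0,1\}$, $H$ standard, $G\ominus H$ standard, and not all labels of $H$ zero. A standard decomposition of $G$ is a finite multiset of standard components of $G$ with sum $G$. A labeled graph is canonical if it is standard, has no directed cycles, all labels are positive, and $\ell(a)<\ell(b)$ for every edge $(a,b)$. -}

module Defs where

open import Data.Nat using (ℕ)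
open import Data.Integer using (ℤ; _+_; _-_; _≤_; _<_; 0ℤ; 1ℤ)
open import Data.Bool using (Bool; false; T)
open import Data.Fin using (Fin)
open import Data.Vec using (Vec; lookup; zipWith; replicate)
open import Data.List using (List; foldr)
open import Data.List.Relation.Unary.All using (All)
open import Data.List.Relation.Binary.Permutation.Propositional using (↭-setoid)
open import Data.Product using (Σ; ∃; _×_; proj₁)
open import Data.Sum using (_⊎_)
open import Relation.Nullary using (¬_)
open import Relation.Binary.PropositionalEquality using (_≡_; setoid)
open import Relation.Binary.Bundles using (Setoid)
import Relation.Binary.Construct.On as On

-- A labeled graph: node set Fin n, a loopless edge relation (a relation,
-- so there are no parallel edges), and an integer label for each node.
record LGraph : Set where
  field
    n        : ℕ
    edge     : Fin n → Fin n → Bool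
    loopless : ∀ a → edge a a ≡ false
    label    : Vec ℤ n

open LGraph public

-- Labels on the nodes/edges of G (same nodes and edges, other labels).
Labels : LGraph → Set
Labels G = Vec ℤ (n G)

StdLabels : (G : LGraph) → Labels G → Set
StdLabels G ℓ =
  (∀ a → 0ℤ ≤ lookup ℓ a) × (∀ a b → T (edge G a b) → lookup ℓ a ≤ lookup ℓ b)

Standard : LGraph → Set
Standard G = StdLabels G (label G)

_⊖_ : {m : ℕ} → Vec ℤ m → Vec ℤ m → Vec ℤ m
_⊖_ = zipWith _-_

_⊕_ : {m : ℕ} → Vec ℤ m → Vec ℤ m → Vec ℤ m
_⊕_ = zipWith _+_

IsStdComponent : (G : LGraph) → Labels G → Set
IsStdComponent G h =
  (∀ a → lookup h a ≡ 0ℤ ⊎ lookup h a ≡ 1ℤ)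
  × StdLabels G h
  × StdLabels G (label G ⊖ h)
  × ¬ (∀ a → lookup h a ≡ 0ℤ)

sumLabels : {m : ℕ} → List (Vec ℤ m) → Vec ℤ m
sumLabels {m} = foldr _⊕_ (replicate m 0ℤ)

-- Standard decomposition, represented by a list (multiset up to permutation).
IsStdDecomposition : (G : LGraph) → List (Labels G) → Set
IsStdDecomposition G L = All (IsStdComponent G) L × sumLabels L ≡ label G

ComponentSetoid : LGraph → Setoid _ _
ComponentSetoid G = On.setoid {B = Σ (Labels G) (IsStdComponent G)} (setoid (Labels G)) proj₁

DecompositionSetoid : LGraph → Setoid _ _
DecompositionSetoid G =
  On.setoid {B = Σ (List (Labels G)) (IsStdDecomposition G)} ↭-setoid proj₁

data Path (G : LGraph) : Fin (n G) → Fin (n G) → Set where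
  edge₁ : ∀ {a b} → T (edge G a b) → Path G a b
  _∷ₚ_  : ∀ {a b c} → T (edge G a b) → Path G b c → Path G a c

NoDirectedCycle : LGraph → Set
NoDirectedCycle G = ∀ a → ¬ Path G a a

Canonical : LGraph → Set
Canonical G =
  Standard G
  × NoDirectedCycle G
  × (∀ a → 0ℤ < lookup (label G) a)
  × (∀ a b → T (edge G a b) → lookup (label G) a < lookup (label G) b)

module Submission where

-- Call an edge a → b of a standard graph G flat when ℓ a = ℓ b; the level
-- classes are the classes of the equivalence closure of flat edges.  A standard component h
-- has 0/1 values with h and ℓ - h both monotone, so h is constant along flat edges (hence on
-- level classes) and vanishes wherever ℓ does.  The canonical graph G' has one node for each
-- level class of positive label, carrying that label, and an edge between two classes when
-- an edge of G joins them and the label strictly rises; so labels rise along paths of G'.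
-- Restriction (read a labeling of G at class representatives) and extension (spread a
-- labeling of G' over the classes, with 0 on label-0 nodes) are additive, carry standard
-- components to standard components both ways and are mutually inverse on them; a general
-- transport lemma turns such a correspondence into bijections between the components and
-- between the decompositions (lists up to permutation) of G and G'.

open import Defs
open import Level using (0ℓ)
open import Data.Product using (Σ; ∃; _×_; _,_; proj₁; proj₂)
open import Data.Sum using (_⊎_; inj₁; inj₂)
open import Data.Empty using (⊥-elim)
open import Data.Nat using (ℕ; z≤n)
open import Data.Integer using (ℤ; _+_; _-_; _≤_; _<_; 0ℤ; 1ℤ; +≤+)
open import Data.Integer.Properties
  using ( ≤-refl; ≤-antisym; <⇒≤; ≤∧≢⇒<; <-irrefl; <-trans; <-≤-trans; ≮⇒≥; +-identityʳ
        ; i≤j⇒0≤j-i; 0≤i-j⇒j≤i)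
  renaming (_≟_ to _≟ℤ_; _<?_ to _<ℤ?_)
open import Data.Integer.Tactic.RingSolver using (solve-∀)
open import Data.Bool using (T; false)
open import Data.Fin using (Fin; zero; suc)
open import Data.Fin.Properties using (any?) renaming (_≟_ to _≟ᶠ_)
open import Data.Vec using (Vec; lookup; tabulate; replicate; zipWith)
open import Data.Vec.Properties
  using (lookup-zipWith; lookup-replicate; lookup∘tabulate; tabulate∘lookup; tabulate-cong)
open import Data.List as List using (List; []; _∷_; map; filter; allFin; cartesianProduct; length)
open import Data.List.Relation.Unary.All as All using (All; []; _∷_)
open import Data.List.Relation.Unary.All.Properties using (map⁺)
open import Data.List.Relation.Unary.Any as Any using (here; there)
open import Data.List.Relation.Unary.Any.Properties using (lookup-index)
open import Data.List.Relation.Unary.AllPairs using (_∷_)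
open import Data.List.Relation.Unary.Unique.Propositional using (Unique)
open import Data.List.Relation.Unary.Unique.Propositional.Properties using (filter⁺; allFin⁺)
open import Data.List.Membership.Propositional using (_∈_)
open import Data.List.Membership.Propositional.Properties
  using (∈-filter⁺; ∈-filter⁻; ∈-allFin; ∈-lookup; ∈-cartesianProduct⁺)
open import Data.List.Relation.Binary.Permutation.Propositional using (↭-reflexive)
import Data.List.Relation.Binary.Permutation.Propositional.Properties as Perm
open import Function.Bundles using (Bijection)
open import Function.Definitions using (Congruent)
open import Function.Properties.Inverse using (Inverse⇒Bijection)
open import Function.Consequences.Setoid using (strictlyInverseˡ⇒inverseˡ; strictlyInverseʳ⇒inverseʳ)
open import Relation.Nullary using (¬_; yes; no)
open import Relation.Nullary.Decidable using (_×-dec_; isYes; toWitness; fromWitness; T?)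
import Relation.Unary
open Relation.Unary using (Pred)
open import Relation.Binary using (Rel; Decidable; Setoid)
open import Relation.Binary.Construct.Closure.Equivalence as EqClosure using (EqClosure)
open import Relation.Binary.Construct.Closure.ReflexiveTransitive using (_◅◅_)
open import Relation.Binary.PropositionalEquality
  using (_≡_; refl; sym; trans; cong; cong₂; subst; subst₂; isEquivalence; module ≡-Reasoning)

lookup-ext : ∀ {A : Set} {k} {v w : Vec A k} → (∀ i → lookup v i ≡ lookup w i) → v ≡ w
lookup-ext {v = v} {w} same = trans (sym (tabulate∘lookup v)) (trans (tabulate-cong same) (tabulate∘lookup w))

lookup-⊕ : ∀ {k} (x y : Vec ℤ k) i → lookup (x ⊕ y) i ≡ lookup x i + lookup y i
lookup-⊕ x y i = lookup-zipWith _+_ i x y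

lookup-⊖ : ∀ {k} (x y : Vec ℤ k) i → lookup (x ⊖ y) i ≡ lookup x i - lookup y i
lookup-⊖ x y i = lookup-zipWith _-_ i x y

sumLabels-map : ∀ {p q} (f : Vec ℤ p → Vec ℤ q) →
  (∀ x y → f (x ⊕ y) ≡ f x ⊕ f y) → f (replicate p 0ℤ) ≡ replicate q 0ℤ →
  ∀ xs → f (sumLabels xs) ≡ sumLabels (map f xs)
sumLabels-map f f-⊕ f-0 []       = f-0
sumLabels-map f f-⊕ f-0 (x ∷ xs) = trans (f-⊕ x _) (cong (f x ⊕_) (sumLabels-map f f-⊕ f-0 xs))

map-inverse : ∀ {A B : Set} {P : Pred A 0ℓ} (f : A → B) (g : B → A) →
  (∀ {x} → P x → g (f x) ≡ x) → ∀ {xs} → All P xs → map g (map f xs) ≡ xs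
map-inverse f g gf []         = refl
map-inverse f g gf (px ∷ pxs) = cong₂ _∷_ (gf px) (map-inverse f g gf pxs)

lookup-injective : ∀ {A : Set} {xs : List A} → Unique xs →
  ∀ {i j} → List.lookup xs i ≡ List.lookup xs j → i ≡ j
lookup-injective (_ ∷ _)    {zero}  {zero}  _  = refl
lookup-injective (x∉ ∷ _)   {zero}  {suc j} eq = ⊥-elim (All.lookup x∉ (∈-lookup j) eq)
lookup-injective (x∉ ∷ _)   {suc i} {zero}  eq = ⊥-elim (All.lookup x∉ (∈-lookup i) (sym eq))
lookup-injective (_ ∷ uniq) {suc i} {suc j} eq = cong suc (lookup-injective uniq eq)

sub-cancelˡ-≤ : ∀ x y z → x - y ≤ x - z → z ≤ y
sub-cancelˡ-≤ x y z le =
  0≤i-j⇒j≤i (subst (0ℤ ≤_) (difference x y z) (i≤j⇒0≤j-i le))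
  where
  difference : ∀ x y z → (x - z) - (x - y) ≡ y - z
  difference = solve-∀

binary-nonneg : ∀ {u} → u ≡ 0ℤ ⊎ u ≡ 1ℤ → 0ℤ ≤ u
binary-nonneg (inj₁ refl) = +≤+ z≤n
binary-nonneg (inj₂ refl) = +≤+ z≤n

inverses⇒bijection : ∀ {a b ℓ₁ ℓ₂} (S : Setoid a ℓ₁) (U : Setoid b ℓ₂) →
  let open Setoid S renaming (Carrier to A; _≈_ to _≈₁_)
      open Setoid U renaming (Carrier to B; _≈_ to _≈₂_) in
  (f : A → B) (g : B → A) → Congruent _≈₁_ _≈₂_ f → Congruent _≈₂_ _≈₁_ g →
  (∀ y → f (g y) ≈₂ y) → (∀ x → g (f x) ≈₁ x) → Bijection S U
inverses⇒bijection S U f g f-cong g-cong fg gf = Inverse⇒Bijection record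
  { to        = f
  ; from      = g
  ; to-cong   = f-cong
  ; from-cong = g-cong
  ; inverse   = strictlyInverseˡ⇒inverseˡ S U f-cong fg , strictlyInverseʳ⇒inverseʳ S U g-cong gf
  }

-- The classes of the equivalence closure of a decidable relation on Fin N, computed by
-- union–find: starting from the identity, every related pair (a , b) redirects the class
-- of b to the representative of a.
module Classes {N : ℕ} {_∼_ : Rel (Fin N) 0ℓ} (_∼?_ : Decidable _∼_) where

  SameClass : Rel (Fin N) 0ℓ
  SameClass = EqClosure _∼_

  record Representation (r : Fin N → Fin N) : Set where
    field
      sound : ∀ x → SameClass x (r x)
      idem  : ∀ x → r (r x) ≡ r x
  open Representation

  merge : (Fin N → Fin N) → Fin N → Fin N → Fin N → Fin N
  merge r a b x with r x ≟ᶠ r b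
  ... | yes _ = r a
  ... | no  _ = r x

  merge-representation : ∀ {r a b} → Representation r → SameClass a b → Representation (merge r a b)
  sound (merge-representation {r} {a} {b} ρ a≈b) x with r x ≟ᶠ r b
  ... | yes rx≡rb = sound ρ x ◅◅ subst (λ y → SameClass y (r a)) (sym rx≡rb) rb≈ra
    where
    rb≈ra : SameClass (r b) (r a)
    rb≈ra = EqClosure.symmetric _ (sound ρ b) ◅◅ (EqClosure.symmetric _ a≈b ◅◅ sound ρ a)
  ... | no  _ = sound ρ x
  idem (merge-representation {r} {a} {b} ρ a≈b) x with r x ≟ᶠ r b
  idem (merge-representation {r} {a} {b} ρ a≈b) x | yes _ with r (r a) ≟ᶠ r b
  ... | yes _ = refl
  ... | no  _ = idem ρ a
  idem (merge-representation {r} {a} {b} ρ a≈b) x | no rx≢rb with r (r x) ≟ᶠ r b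
  ... | yes rrx≡rb = ⊥-elim (rx≢rb (trans (sym (idem ρ x)) rrx≡rb))
  ... | no  _ = idem ρ x

  merge-coarsens : ∀ r a b {x y} → r x ≡ r y → merge r a b x ≡ merge r a b y
  merge-coarsens r a b {x} {y} rx≡ry with r x ≟ᶠ r b | r y ≟ᶠ r b
  ... | yes _     | yes _     = refl
  ... | yes rx≡rb | no  ry≢rb = ⊥-elim (ry≢rb (trans (sym rx≡ry) rx≡rb))
  ... | no  rx≢rb | yes ry≡rb = ⊥-elim (rx≢rb (trans rx≡ry ry≡rb))
  ... | no  _     | no  _     = rx≡ry

  merge-joins : ∀ r a b → merge r a b a ≡ merge r a b b
  merge-joins r a b with r a ≟ᶠ r b | r b ≟ᶠ r b
  ... | _         | no rb≢rb = ⊥-elim (rb≢rb refl)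
  ... | yes _     | yes _    = refl
  ... | no  _     | yes _    = refl

  mergeAll : List (Fin N × Fin N) → (Fin N → Fin N) → Fin N → Fin N
  mergeAll []             r = r
  mergeAll ((a , b) ∷ ps) r with a ∼? b
  ... | yes _ = mergeAll ps (merge r a b)
  ... | no  _ = mergeAll ps r

  mergeAll-representation : ∀ ps {r} → Representation r → Representation (mergeAll ps r)
  mergeAll-representation []             ρ = ρ
  mergeAll-representation ((a , b) ∷ ps) ρ with a ∼? b
  ... | yes a∼b = mergeAll-representation ps (merge-representation ρ (EqClosure.return a∼b))
  ... | no  _   = mergeAll-representation ps ρ

  mergeAll-coarsens : ∀ ps r {x y} → r x ≡ r y → mergeAll ps r x ≡ mergeAll ps r y
  mergeAll-coarsens []             r eq = eq
  mergeAll-coarsens ((a , b) ∷ ps) r eq with a ∼? b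
  ... | yes _ = mergeAll-coarsens ps (merge r a b) (merge-coarsens r a b eq)
  ... | no  _ = mergeAll-coarsens ps r eq

  mergeAll-joins : ∀ ps r {a b} → (a , b) ∈ ps → a ∼ b → mergeAll ps r a ≡ mergeAll ps r b
  mergeAll-joins ((a , b) ∷ ps) r (here refl) a∼b with a ∼? b
  ... | yes _   = mergeAll-coarsens ps (merge r a b) (merge-joins r a b)
  ... | no  a≁b = ⊥-elim (a≁b a∼b)
  mergeAll-joins ((c , d) ∷ ps) r (there p) a∼b with c ∼? d
  ... | yes _ = mergeAll-joins ps (merge r c d) p a∼b
  ... | no  _ = mergeAll-joins ps r p a∼b

  allPairs : List (Fin N × Fin N)
  allPairs = cartesianProduct (allFin N) (allFin N)

  classOf : Fin N → Fin N
  classOf = mergeAll allPairs (λ x → x)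

  classOf-representation : Representation classOf
  classOf-representation = mergeAll-representation allPairs
    record { sound = λ _ → EqClosure.reflexive _ ; idem = λ _ → refl }

  classOf-sound : ∀ x → SameClass x (classOf x)
  classOf-sound = sound classOf-representation

  classOf-idem : ∀ x → classOf (classOf x) ≡ classOf x
  classOf-idem = idem classOf-representation

  classOf-joins : ∀ {a b} → a ∼ b → classOf a ≡ classOf b
  classOf-joins = mergeAll-joins allPairs (λ x → x) (∈-cartesianProduct⁺ (∈-allFin _) (∈-allFin _))

  invariant : ∀ {B : Set} (f : Fin N → B) → (∀ {a b} → a ∼ b → f a ≡ f b) →
    ∀ x → f (classOf x) ≡ f x
  invariant f f-resp x = sym (EqClosure.gfold isEquivalence f f-resp (classOf-sound x))

module Enumeration {N : ℕ} {P : Pred (Fin N) 0ℓ} (P? : Relation.Unary.Decidable P) where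

  members : List (Fin N)
  members = filter P? (allFin N)

  size : ℕ
  size = length members

  elem : Fin size → Fin N
  elem = List.lookup members

  elem-member : ∀ i → P (elem i)
  elem-member i = proj₂ (∈-filter⁻ P? {xs = allFin N} (∈-lookup i))

  elem-injective : ∀ {i j} → elem i ≡ elem j → i ≡ j
  elem-injective = lookup-injective (filter⁺ P? (allFin⁺ N))

  elem-onto : ∀ {x} → P x → ∃ λ i → elem i ≡ x
  elem-onto {x} px = Any.index x∈ , sym (lookup-index x∈)
    where
    x∈ : x ∈ members
    x∈ = ∈-filter⁺ P? (∈-allFin x) px

-- Standard components are rigid along flat edges and on label-0 nodes.  Both h and ℓ - h
-- increase along an edge; if ℓ does not increase, h cannot either.
component-flat : ∀ {G h} → IsStdComponent G h → ∀ {a b} → T (edge G a b) →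
  lookup (label G) a ≡ lookup (label G) b → lookup h a ≡ lookup h b
component-flat {G} {h} (_ , (_ , mono) , (_ , slack-mono) , _) {a} {b} e ℓa≡ℓb =
  ≤-antisym (mono a b e) (sub-cancelˡ-≤ (lookup (label G) a) (lookup h a) (lookup h b) slack)
  where
  slack : lookup (label G) a - lookup h a ≤ lookup (label G) a - lookup h b
  slack = subst₂ _≤_ (lookup-⊖ (label G) h a)
                     (trans (lookup-⊖ (label G) h b) (cong (_- lookup h b) (sym ℓa≡ℓb)))
                     (slack-mono a b e)

component-vanishes : ∀ {G h} → IsStdComponent G h →
  ∀ {a} → lookup (label G) a ≡ 0ℤ → lookup h a ≡ 0ℤ
component-vanishes {G} {h} (binary , _ , (slack-nonneg , _) , _) {a} ℓa≡0 with binary a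
... | inj₁ ha≡0 = ha≡0
... | inj₂ ha≡1 =
  ⊥-elim (negative (subst (0ℤ ≤_) (trans (lookup-⊖ (label G) h a) (cong₂ _-_ ℓa≡0 ha≡1))
                                 (slack-nonneg a)))
  where
  negative : ¬ (0ℤ ≤ 0ℤ - 1ℤ)
  negative ()

record Transfer (G G' : LGraph) : Set where
  field
    apply           : Labels G → Labels G'
    apply-⊕         : ∀ x y → apply (x ⊕ y) ≡ apply x ⊕ apply y
    apply-0         : apply (replicate (n G) 0ℤ) ≡ replicate (n G') 0ℤ
    apply-label     : apply (label G) ≡ label G'
    apply-component : ∀ {h} → IsStdComponent G h → IsStdComponent G' (apply h)

  component : Σ (Labels G) (IsStdComponent G) → Σ (Labels G') (IsStdComponent G')
  component (h , comp) = apply h , apply-component comp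

  decomposition : Σ (List (Labels G)) (IsStdDecomposition G) → Σ (List (Labels G')) (IsStdDecomposition G')
  decomposition (hs , comps , sum≡) = map apply hs , map⁺ (All.map apply-component comps) , sum≡′
    where
    open ≡-Reasoning
    sum≡′ : sumLabels (map apply hs) ≡ label G'
    sum≡′ = begin
      sumLabels (map apply hs) ≡⟨ sumLabels-map apply apply-⊕ apply-0 hs ⟨
      apply (sumLabels hs)     ≡⟨ cong apply sum≡ ⟩
      apply (label G)          ≡⟨ apply-label ⟩
      label G'                 ∎

record Correspondence (G G' : LGraph) : Set where
  field
    forth      : Transfer G G'
    back       : Transfer G' G
    back-forth : ∀ {h} → IsStdComponent G h → Transfer.apply back (Transfer.apply forth h) ≡ h
    forth-back : ∀ {h'} → IsStdComponent G' h' → Transfer.apply forth (Transfer.apply back h') ≡ h'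

module _ {G G' : LGraph} (corr : Correspondence G G') where
  open Correspondence corr
  open Transfer forth renaming (apply to f; component to f-component; decomposition to f-decomposition)
  open Transfer back  renaming (apply to g; component to g-component; decomposition to g-decomposition)

  component-bijection : Bijection (ComponentSetoid G) (ComponentSetoid G')
  component-bijection = inverses⇒bijection (ComponentSetoid G) (ComponentSetoid G')
    f-component g-component (cong f) (cong g)
    (λ (h' , comp') → forth-back comp') (λ (h , comp) → back-forth comp)

  decomposition-bijection : Bijection (DecompositionSetoid G) (DecompositionSetoid G')
  decomposition-bijection = inverses⇒bijection (DecompositionSetoid G) (DecompositionSetoid G')
    f-decomposition g-decomposition (Perm.map⁺ f) (Perm.map⁺ g)
    (λ (hs' , comps' , _) → ↭-reflexive (map-inverse g f forth-back comps'))
    (λ (hs , comps , _) → ↭-reflexive (map-inverse f g back-forth comps))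

module Compression (G : LGraph) (std : Standard G) where

  N : ℕ
  N = n G

  ℓ : Fin N → ℤ
  ℓ = lookup (label G)

  -- Labels are nonnegative, so a label that is not positive is zero.
  not-positive : ∀ {a} → ¬ (0ℤ < ℓ a) → ℓ a ≡ 0ℤ
  not-positive {a} ¬pos = ≤-antisym (≮⇒≥ ¬pos) (proj₁ std a)

  Flat : Rel (Fin N) 0ℓ
  Flat a b = T (edge G a b) × ℓ a ≡ ℓ b

  flat? : Decidable Flat
  flat? a b = T? (edge G a b) ×-dec (ℓ a ≟ℤ ℓ b)

  open Classes flat? using (classOf; classOf-idem; classOf-joins; invariant)

  ClassInvariant : Vec ℤ N → Set
  ClassInvariant v = ∀ {a b} → Flat a b → lookup v a ≡ lookup v b

  classOf-label : ∀ a → ℓ (classOf a) ≡ ℓ a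
  classOf-label = invariant ℓ proj₂

  -- The nodes of G' are the classes of positive label, named by their representatives.
  Representative : Pred (Fin N) 0ℓ
  Representative x = 0ℤ < ℓ x × classOf x ≡ x

  representative? : Relation.Unary.Decidable Representative
  representative? x = (0ℤ <ℤ? ℓ x) ×-dec (classOf x ≟ᶠ x)

  open Enumeration representative?
    renaming (size to m; elem to rep; elem-member to rep-representative;
              elem-injective to rep-injective; elem-onto to rep-onto)

  node-of : ∀ a → 0ℤ < ℓ a → ∃ λ i → rep i ≡ classOf a
  node-of a pos = rep-onto (subst (0ℤ <_) (sym (classOf-label a)) pos , classOf-idem a)

  node-unique : ∀ {i j a} → rep i ≡ classOf a → rep j ≡ classOf a → i ≡ j
  node-unique ia ja = rep-injective (trans ia (sym ja))

  rep-label : ∀ {i a} → rep i ≡ classOf a → ℓ (rep i) ≡ ℓ a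
  rep-label {a = a} ia = trans (cong ℓ ia) (classOf-label a)

  rep-own-class : ∀ i → rep i ≡ classOf (rep i)
  rep-own-class i = sym (proj₂ (rep-representative i))

  node-positive : ∀ {i a} → rep i ≡ classOf a → 0ℤ < ℓ a
  node-positive {i} ia = subst (0ℤ <_) (rep-label ia) (proj₁ (rep-representative i))

  Rise : Rel (Fin N) 0ℓ
  Rise x y = (∃ λ a → ∃ λ b → T (edge G a b) × classOf a ≡ x × classOf b ≡ y) × ℓ x < ℓ y

  rise? : Decidable Rise
  rise? x y =
    any? (λ a → any? (λ b → T? (edge G a b) ×-dec (classOf a ≟ᶠ x) ×-dec (classOf b ≟ᶠ y)))
    ×-dec (ℓ x <ℤ? ℓ y)

  rise-loopless : ∀ x → isYes (rise? x x) ≡ false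
  rise-loopless x with rise? x x
  ... | yes (_ , ℓx<ℓx) = ⊥-elim (<-irrefl refl ℓx<ℓx)
  ... | no  _           = refl

  restrict : Vec ℤ N → Vec ℤ m
  restrict v = tabulate (λ i → lookup v (rep i))

  lookup-restrict : ∀ v i → lookup (restrict v) i ≡ lookup v (rep i)
  lookup-restrict v i = lookup∘tabulate _ i

  G' : LGraph
  G' = record
    { n        = m
    ; edge     = λ i j → isYes (rise? (rep i) (rep j))
    ; loopless = λ i → rise-loopless (rep i)
    ; label    = restrict (label G)
    }

  ℓ' : Fin m → ℤ
  ℓ' = lookup (label G')

  ℓ'-positive : ∀ i → 0ℤ < ℓ' i
  ℓ'-positive i = subst (0ℤ <_) (sym (lookup-restrict (label G) i)) (proj₁ (rep-representative i))

  ℓ'-rises : ∀ i j → T (edge G' i j) → ℓ' i < ℓ' j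
  ℓ'-rises i j e =
    subst₂ _<_ (sym (lookup-restrict (label G) i)) (sym (lookup-restrict (label G) j)) (proj₂ (toWitness e))

  -- Labels rise strictly along every path, so no path returns to its start.
  path-rises : ∀ {i j} → Path G' i j → ℓ' i < ℓ' j
  path-rises (edge₁ e) = ℓ'-rises _ _ e
  path-rises (e ∷ₚ p)  = <-trans (ℓ'-rises _ _ e) (path-rises p)

  canonical : Canonical G'
  canonical = ((λ i → <⇒≤ (ℓ'-positive i)) , (λ i j e → <⇒≤ (ℓ'-rises i j e)))
            , (λ i p → <-irrefl refl (path-rises p))
            , ℓ'-positive
            , ℓ'-rises

  restrict-zipWith : ∀ (_∙_ : ℤ → ℤ → ℤ) x y →
    restrict (zipWith _∙_ x y) ≡ zipWith _∙_ (restrict x) (restrict y)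
  restrict-zipWith _∙_ x y = lookup-ext λ i → begin
    lookup (restrict (zipWith _∙_ x y)) i             ≡⟨ lookup-restrict (zipWith _∙_ x y) i ⟩
    lookup (zipWith _∙_ x y) (rep i)                   ≡⟨ lookup-zipWith _∙_ (rep i) x y ⟩
    lookup x (rep i) ∙ lookup y (rep i)                ≡⟨ cong₂ _∙_ (lookup-restrict x i) (lookup-restrict y i) ⟨
    lookup (restrict x) i ∙ lookup (restrict y) i      ≡⟨ lookup-zipWith _∙_ i (restrict x) (restrict y) ⟨
    lookup (zipWith _∙_ (restrict x) (restrict y)) i   ∎
    where open ≡-Reasoning

  restrict-0 : restrict (replicate N 0ℤ) ≡ replicate m 0ℤ
  restrict-0 = lookup-ext λ i →
    trans (lookup-restrict (replicate N 0ℤ) i) (trans (lookup-replicate (rep i) 0ℤ) (sym (lookup-replicate i 0ℤ)))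

  restrict-at-node : ∀ v → ClassInvariant v →
    ∀ {i a} → rep i ≡ classOf a → lookup (restrict v) i ≡ lookup v a
  restrict-at-node v inv {i} {a} ia =
    trans (lookup-restrict v i) (trans (cong (lookup v) ia) (invariant (lookup v) inv a))

  component-invariant : ∀ h → IsStdComponent G h → ClassInvariant h
  component-invariant h comp (ab , ℓa≡ℓb) = component-flat {G} {h} comp ab ℓa≡ℓb

  -- Every edge of G' comes from an edge of G, so restriction preserves standardness.
  restrict-std : ∀ v → ClassInvariant v → StdLabels G v → StdLabels G' (restrict v)
  restrict-std v inv (nonneg , mono) =
      (λ i → subst (0ℤ ≤_) (sym (lookup-restrict v i)) (nonneg (rep i)))
    , λ i j e → let ((a , b , ab , ai , bj) , _) = toWitness e in
        subst₂ _≤_ (sym (restrict-at-node v inv (sym ai))) (sym (restrict-at-node v inv (sym bj))) (mono a b ab)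

  restrict-component : ∀ {h} → IsStdComponent G h → IsStdComponent G' (restrict h)
  restrict-component {h} comp@(binary , h-std , slack-std , nonzero) =
      (λ i → subst (λ t → t ≡ 0ℤ ⊎ t ≡ 1ℤ) (sym (lookup-restrict h i)) (binary (rep i)))
    , restrict-std h (component-invariant h comp) h-std
    , subst (StdLabels G') (restrict-zipWith _-_ (label G) h) (restrict-std (label G ⊖ h) slack-invariant slack-std)
    , λ zero' → nonzero (vanishes zero')
    where
    slack-invariant : ClassInvariant (label G ⊖ h)
    slack-invariant {a} {b} (ab , ℓa≡ℓb) = begin
      lookup (label G ⊖ h) a   ≡⟨ lookup-⊖ (label G) h a ⟩
      ℓ a - lookup h a         ≡⟨ cong₂ _-_ ℓa≡ℓb (component-invariant h comp (ab , ℓa≡ℓb)) ⟩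
      ℓ b - lookup h b         ≡⟨ lookup-⊖ (label G) h b ⟨
      lookup (label G ⊖ h) b   ∎
      where open ≡-Reasoning
    -- h vanishes on label-0 nodes, and elsewhere it is read off G'.
    vanishes : (∀ i → lookup (restrict h) i ≡ 0ℤ) → ∀ a → lookup h a ≡ 0ℤ
    vanishes zero' a with 0ℤ <ℤ? ℓ a
    ... | yes pos = let (i , ia) = node-of a pos in
                    trans (sym (restrict-at-node h (component-invariant h comp) ia)) (zero' i)
    ... | no ¬pos = component-vanishes {G} {h} comp (not-positive ¬pos)

  extendAt : Vec ℤ m → Fin N → ℤ
  extendAt h' a with 0ℤ <ℤ? ℓ a
  ... | yes pos = lookup h' (proj₁ (node-of a pos))
  ... | no  _   = 0ℤ

  extend : Vec ℤ m → Vec ℤ N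
  extend h' = tabulate (extendAt h')

  data ExtensionView (h' : Vec ℤ m) (a : Fin N) : ℤ → Set where
    at-zero : ℓ a ≡ 0ℤ → ExtensionView h' a 0ℤ
    at-node : ∀ i → rep i ≡ classOf a → ExtensionView h' a (lookup h' i)

  extension-view : ∀ h' a → ExtensionView h' a (lookup (extend h') a)
  extension-view h' a rewrite lookup∘tabulate (extendAt h') a with 0ℤ <ℤ? ℓ a
  ... | yes pos = at-node _ (proj₂ (node-of a pos))
  ... | no ¬pos = at-zero (not-positive ¬pos)

  extend-at-zero : ∀ h' {a} → ℓ a ≡ 0ℤ → lookup (extend h') a ≡ 0ℤ
  extend-at-zero h' {a} ℓa≡0 = entry (extension-view h' a)
    where
    entry : ∀ {u} → ExtensionView h' a u → u ≡ 0ℤ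
    entry (at-zero _)    = refl
    entry (at-node i ia) = ⊥-elim (<-irrefl (sym ℓa≡0) (node-positive ia))

  extend-at-node : ∀ h' {i a} → rep i ≡ classOf a → lookup (extend h') a ≡ lookup h' i
  extend-at-node h' {i} {a} ia = entry (extension-view h' a)
    where
    entry : ∀ {u} → ExtensionView h' a u → u ≡ lookup h' i
    entry (at-zero ℓa≡0) = ⊥-elim (<-irrefl (sym ℓa≡0) (node-positive ia))
    entry (at-node j ja) = cong (lookup h') (node-unique ja ia)

  restrict-extend : ∀ h' → restrict (extend h') ≡ h'
  restrict-extend h' = lookup-ext λ i →
    trans (lookup-restrict (extend h') i) (extend-at-node h' (rep-own-class i))

  extend-restrict : ∀ v → ClassInvariant v → (∀ a → ℓ a ≡ 0ℤ → lookup v a ≡ 0ℤ) →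
    extend (restrict v) ≡ v
  extend-restrict v inv vanishes = lookup-ext λ a → entry a (extension-view (restrict v) a)
    where
    entry : ∀ a {u} → ExtensionView (restrict v) a u → u ≡ lookup v a
    entry a (at-zero ℓa≡0) = sym (vanishes a ℓa≡0)
    entry a (at-node i ia) = restrict-at-node v inv ia

  extend-label : extend (label G') ≡ label G
  extend-label = extend-restrict (label G) proj₂ (λ _ ℓa≡0 → ℓa≡0)

  extend-⊕ : ∀ x y → extend (x ⊕ y) ≡ extend x ⊕ extend y
  extend-⊕ x y = lookup-ext λ a → trans (entry a) (sym (lookup-⊕ (extend x) (extend y) a))
    where
    entry : ∀ a → lookup (extend (x ⊕ y)) a ≡ lookup (extend x) a + lookup (extend y) a
    entry a with 0ℤ <ℤ? ℓ a
    ... | yes pos = let (i , ia) = node-of a pos in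
      trans (extend-at-node (x ⊕ y) ia)
        (trans (lookup-⊕ x y i) (sym (cong₂ _+_ (extend-at-node x ia) (extend-at-node y ia))))
    ... | no ¬pos = let ℓa≡0 = not-positive ¬pos in
      trans (extend-at-zero (x ⊕ y) ℓa≡0)
        (sym (cong₂ _+_ (extend-at-zero x ℓa≡0) (extend-at-zero y ℓa≡0)))

  extend-0 : extend (replicate m 0ℤ) ≡ replicate N 0ℤ
  extend-0 = lookup-ext λ a → trans (entry (extension-view (replicate m 0ℤ) a)) (sym (lookup-replicate a 0ℤ))
    where
    entry : ∀ {a u} → ExtensionView (replicate m 0ℤ) a u → u ≡ 0ℤ
    entry (at-zero _)   = refl
    entry (at-node i _) = lookup-replicate i 0ℤ

  slack-at : ∀ h' {i a} → rep i ≡ classOf a → lookup (label G' ⊖ h') i ≡ ℓ a - lookup h' i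
  slack-at h' {i} ia =
    trans (lookup-⊖ (label G') h' i) (cong (_- lookup h' i) (trans (lookup-restrict (label G) i) (rep-label ia)))

  view-binary : ∀ {h'} → IsStdComponent G' h' → ∀ {a u} → ExtensionView h' a u → u ≡ 0ℤ ⊎ u ≡ 1ℤ
  view-binary _             (at-zero _)   = inj₁ refl
  view-binary (binary' , _) (at-node i _) = binary' i

  view-slack : ∀ {h'} → IsStdComponent G' h' → ∀ {a u} → ExtensionView h' a u → 0ℤ ≤ ℓ a - u
  view-slack _ {a} (at-zero _) = subst (0ℤ ≤_) (sym (+-identityʳ (ℓ a))) (proj₁ std a)
  view-slack {h'} (_ , _ , (slack-nonneg' , _) , _) (at-node i ia) =
    subst (0ℤ ≤_) (slack-at h' ia) (slack-nonneg' i)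

  -- Along an edge a → b of G the extension and its slack both increase: trivially from a
  -- label-0 node, not at all inside one class, and along an edge of G' between classes.
  view-edge : ∀ {h'} → IsStdComponent G' h' → ∀ {a b u w} → T (edge G a b) →
    ExtensionView h' a u → ExtensionView h' b w → u ≤ w × ℓ a - u ≤ ℓ b - w
  view-edge comp' {a} e (at-zero ℓa≡0) vb =
      binary-nonneg (view-binary comp' vb)
    , subst (_≤ _) (sym (trans (+-identityʳ (ℓ a)) ℓa≡0)) (view-slack comp' vb)
  view-edge comp' {a} {b} e (at-node i ia) (at-zero ℓb≡0) =
    ⊥-elim (<-irrefl refl (<-≤-trans (node-positive ia) (subst (ℓ a ≤_) ℓb≡0 (proj₂ std a b e))))
  view-edge {h'} comp' {a} {b} e (at-node i ia) (at-node j jb) with ℓ a ≟ℤ ℓ b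
  ... | yes ℓa≡ℓb with node-unique ia (trans jb (sym (classOf-joins (e , ℓa≡ℓb))))
  ...   | refl = ≤-refl , subst (λ t → ℓ a - lookup h' i ≤ t - lookup h' i) ℓa≡ℓb ≤-refl
  view-edge {h'} (_ , (_ , mono') , (_ , slack-mono') , _) {a} {b} e (at-node i ia) (at-node j jb) | no ℓa≢ℓb =
    mono' i j ij , subst₂ _≤_ (slack-at h' ia) (slack-at h' jb) (slack-mono' i j ij)
    where
    rises : ℓ (rep i) < ℓ (rep j)
    rises = subst₂ _<_ (sym (rep-label ia)) (sym (rep-label jb)) (≤∧≢⇒< (proj₂ std a b e) ℓa≢ℓb)
    ij : T (edge G' i j)
    ij = fromWitness ((a , b , e , sym ia , sym jb) , rises)

  extend-component : ∀ {h'} → IsStdComponent G' h' → IsStdComponent G (extend h')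
  extend-component {h'} comp'@(_ , _ , _ , nonzero') =
      (λ a → view-binary comp' (view a))
    , ((λ a → binary-nonneg (view-binary comp' (view a)))
      , λ a b e → proj₁ (view-edge comp' e (view a) (view b)))
    , ((λ a → subst (0ℤ ≤_) (sym (slack a)) (view-slack comp' (view a)))
      , λ a b e → subst₂ _≤_ (sym (slack a)) (sym (slack b)) (proj₂ (view-edge comp' e (view a) (view b))))
    , λ zero → nonzero' (λ i → trans (sym (extend-at-node h' (rep-own-class i))) (zero (rep i)))
    where
    view : ∀ a → ExtensionView h' a (lookup (extend h') a)
    view = extension-view h'
    slack : ∀ a → lookup (label G ⊖ extend h') a ≡ ℓ a - lookup (extend h') a
    slack = lookup-⊖ (label G) (extend h')

  correspondence : Correspondence G G'
  correspondence = record
    { forth      = record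
      { apply           = restrict
      ; apply-⊕         = restrict-zipWith _+_
      ; apply-0         = restrict-0
      ; apply-label     = refl
      ; apply-component = restrict-component
      }
    ; back       = record
      { apply           = extend
      ; apply-⊕         = extend-⊕
      ; apply-0         = extend-0
      ; apply-label     = extend-label
      ; apply-component = extend-component
      }
    ; back-forth = λ {h} comp →
        extend-restrict h (component-invariant h comp) (λ _ → component-vanishes {G} {h} comp)
    ; forth-back = λ {h'} _ → restrict-extend h'
    }

proposition2p12 : (G : LGraph) → Standard G →
    Σ LGraph (λ G' → Canonical G'
    × Bijection (DecompositionSetoid G) (DecompositionSetoid G')
    × Bijection (ComponentSetoid G) (ComponentSetoid G'))
proposition2p12 G std =
  G' , canonical , decomposition-bijection correspondence , component-bijection correspondence
  where open Compression G std
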